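{- For every integer $n\ge 1$, $\chi_{la}(M_6\vee O_{2n})=3$.
   Context: $M_6$ is the Möbius ladder on 6 vertices: the cycle $u_1u_2u_3u_4u_5u_6u_1$ together with the edges $u_1u_4,u_2u_5,u_3u_6$. $O_k$ is the edgeless graph on $k$ vertices and $G\vee H$ is the join (disjoint union plus all edges between $V(G)$ and $V(H)$). For a graph $G=(V,E)$, a local antimagic labeling is a bijection $f:E\to\{1,\dots,|E|\}$ such that, with $f^+(u)=\sum_{e\ni u} f(e)$, adjacent vertices receive distinct values of $f^+$; $c(f)$ is the number of distinct values of $f^+$ and $\chi_{la}(G)=\min c(f)$ over all local antimagic labelings. -}

module Defs where

open import Data.Nat using (ℕ; zero; suc; _+_; _*_; _≤_)
import Data.Nat as ℕ
open import Data.Fin using (Fin; toℕ; splitAt; remQuot; _↑ˡ_; _↑ʳ_)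
import Data.Fin as F
open import Data.Product using (_×_; _,_; proj₁; proj₂; Σ)
import Data.Product as P
open import Data.Sum using (inj₁; inj₂)
open import Data.Bool using (if_then_else_; _∨_)
open import Data.Nat.ListAction using (sum)
open import Data.List using (List; map; allFin; length; deduplicate)
open import Data.Vec using (Vec; lookup; []; _∷_)
open import Relation.Nullary using (does; ¬_)
open import Relation.Binary.PropositionalEquality using (_≡_)
open import Function.Definitions using (Bijective)

record Graph : Set where
  field
    V    : ℕ
    m    : ℕ
    ends : Fin m → Fin V × Fin V
open Graph public

-- Möbius ladder M_6: vertex u_i is represented by (i-1) : Fin 6.
-- Edges: cycle u1u2u3u4u5u6u1 plus u1u4, u2u5, u3u6.
M6-edges : Vec (Fin 6 × Fin 6) 9
M6-edges =
  (F.# 0 , F.# 1) ∷ (F.# 1 , F.# 2) ∷ (F.# 2 , F.# 3) ∷ (F.# 3 , F.# 4) ∷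
  (F.# 4 , F.# 5) ∷ (F.# 5 , F.# 0) ∷
  (F.# 0 , F.# 3) ∷ (F.# 1 , F.# 4) ∷ (F.# 2 , F.# 5) ∷ []

M6 : Graph
M6 = record { V = 6 ; m = 9 ; ends = lookup M6-edges }

O : ℕ → Graph
O k = record { V = k ; m = 0 ; ends = λ () }

-- Join G ∨ H: vertices of G first, then vertices of H; edges of G, edges
-- of H, then all V(G)×V(H) pairs.
_∨G_ : Graph → Graph → Graph
G ∨G H = record
  { V = V G + V H
  ; m = m G + (m H + V G * V H)
  ; ends = e
  }
  where
  e : Fin (m G + (m H + V G * V H)) → Fin (V G + V H) × Fin (V G + V H)
  e i with splitAt (m G) i
  ... | inj₁ j = P.map (_↑ˡ V H) (_↑ˡ V H) (ends G j)
  ... | inj₂ j with splitAt (m H) j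
  ...   | inj₁ k = P.map (V G ↑ʳ_) (V G ↑ʳ_) (ends H k)
  ...   | inj₂ p with remQuot {V G} (V H) p
  ...     | (a , b) = (a ↑ˡ V H , V G ↑ʳ b)

-- A labeling is a bijection f : E → {1,…,|E|}; we encode the label of
-- edge e as suc (toℕ (f e)) for a bijection f : Fin m → Fin m.
label : (G : Graph) → (Fin (m G) → Fin (m G)) → Fin (m G) → ℕ
label G f e = suc (toℕ (f e))

fplus : (G : Graph) → (Fin (m G) → Fin (m G)) → Fin (V G) → ℕ
fplus G f u = sum (map term (allFin (m G)))
  where
  term : Fin (m G) → ℕ
  term e = if does (u F.≟ proj₁ (ends G e)) ∨ does (u F.≟ proj₂ (ends G e))
           then label G f e else 0

IsLocalAntimagic : (G : Graph) → (Fin (m G) → Fin (m G)) → Set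
IsLocalAntimagic G f =
  Bijective _≡_ _≡_ f ×
  ((e : Fin (m G)) → ¬ (fplus G f (proj₁ (ends G e)) ≡ fplus G f (proj₂ (ends G e))))

c : (G : Graph) → (Fin (m G) → Fin (m G)) → ℕ
c G f = length (deduplicate ℕ._≟_ (map (fplus G f) (allFin (V G))))

-- χ_la(G) = k : k is the minimum of c(f) over local antimagic labelings f
-- (attained, and a lower bound).
χla≡ : Graph → ℕ → Set
χla≡ G k =
  Σ (Fin (m G) → Fin (m G)) (λ f → IsLocalAntimagic G f × c G f ≡ k) ×
  ((f : Fin (m G) → Fin (m G)) → IsLocalAntimagic G f → k ≤ c G f)

module Submission where

-- Lower bound: the vertices u₁, u₂ of M₆ and any vertex of O₂ₙ are pairwise
-- adjacent, so every local antimagic labeling has at least three distinct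
-- vertex sums (triangle⇒3≤c).
--
-- Upper bound: an explicit labeling with exactly three vertex sums.  The nine
-- M₆ edges get the largest labels 12n + 1 + σ k, where σ makes every M₆ vertex
-- sum to 12; so M₆ contributes the same amount at each of its vertices, more
-- than the whole sum at a vertex of O₂ₙ.  The 12n cross edges get 1,…,12n,
-- arranged by a "fold" (pairing x with its reflection) so that pairs of M₆
-- vertices 2j, 2j + 1 always receive complementary labels from each O₂ₙ
-- vertex, and every M₆ vertex on the same side of the bipartite graph M₆ gets
-- the same row sum.  Hence the vertex sums take the values A (even side),
-- B (odd side), C (on O₂ₙ) with C < A < B, and adjacent vertices differ.

open import Defs
open import Data.Nat using (ℕ; zero; suc; _+_; _*_; _∸_; _≤_; _<_; z≤n; s≤s)
open import Data.Nat.Properties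
  using (_≟_; +-assoc; +-comm; +-identityʳ; *-zeroʳ; *-identityˡ; *-distribʳ-+; ≤-trans; ≤-antisym;
         <⇒≤; <⇒≢; m≤m+n; m<m+n; +-mono-≤; +-mono-<-≤; +-monoʳ-<; m+[n∸m]≡n; m+n∸n≡m; module ≤-Reasoning)
open import Data.Nat.ListAction using (sum)
open import Data.Nat.Tactic.RingSolver using (solve-∀)
open import Data.Fin as F using (Fin; toℕ; splitAt; remQuot; combine; cast; opposite; _↑ˡ_; _↑ʳ_)
open import Data.Fin.Patterns using (0F; 1F; 2F; 3F; 4F; 5F; 6F; 7F; 8F)
import Data.Fin.Properties as FP
open import Data.Bool using (Bool; true; false; if_then_else_; _∨_)
open import Data.Bool.Properties using (∨-identityʳ)
open import Data.Product as Prod using (_×_; _,_; proj₁; proj₂)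
open import Data.Sum using (_⊎_; inj₁; inj₂; [_,_]′)
open import Data.Sum.Algebra using (⊎-comm)
open import Data.Sum.Function.Propositional using (_⊎-↔_)
open import Data.Product.Function.NonDependent.Propositional using (_×-↔_)
open import Data.List using (List; []; _∷_; map; allFin; tabulate; length; lookup; deduplicate)
import Data.List.Properties as LP
open import Data.List.Membership.Propositional using (_∈_)
open import Data.List.Membership.Propositional.Properties
  using (∈-lookup; ∈-map⁺; ∈-map⁻; ∈-allFin; ∈-deduplicate⁺; ∈-deduplicate⁻)
open import Data.List.Relation.Unary.Any using (here; there; index)
open import Data.List.Relation.Unary.Any.Properties using (lookup-index)
import Data.List.Relation.Unary.All as All
open import Data.List.Relation.Unary.Unique.Propositional using (Unique; []; _∷_)
open import Data.List.Relation.Unary.Unique.DecPropositional.Properties _≟_ using (deduplicate-!)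
open import Data.List.Relation.Binary.Subset.Propositional using (_⊆_)
open import Data.Empty using (⊥-elim)
open import Relation.Nullary using (does; yes; no)
open import Relation.Nullary.Decidable using (dec-true; dec-false)
open import Relation.Binary.PropositionalEquality
open import Function.Bundles using (_↔_; mk↔ₛ′; Inverse; Bijection)
open import Function.Construct.Composition using (_↔-∘_)
open import Function.Construct.Symmetry using (↔-sym)
open import Function.Construct.Identity using (↔-id)
open import Function.Definitions using (Injective; Bijective)
open import Function.Properties.Inverse using (Inverse⇒Bijection)

∑ : (k : ℕ) → (Fin k → ℕ) → ℕ
∑ zero    g = 0
∑ (suc k) g = g F.zero + ∑ k (λ i → g (F.suc i))

sum-allFin : ∀ k (g : Fin k → ℕ) → sum (map g (allFin k)) ≡ ∑ k g
sum-allFin k g = trans (cong sum (LP.map-tabulate (λ i → i) g)) (sum-tabulate k g)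
  where
  sum-tabulate : ∀ k (g : Fin k → ℕ) → sum (tabulate g) ≡ ∑ k g
  sum-tabulate zero    g = refl
  sum-tabulate (suc k) g = cong (g F.zero +_) (sum-tabulate k (λ i → g (F.suc i)))

∑-cong : ∀ k {g h : Fin k → ℕ} → (∀ i → g i ≡ h i) → ∑ k g ≡ ∑ k h
∑-cong zero    eq = refl
∑-cong (suc k) eq = cong₂ _+_ (eq F.zero) (∑-cong k (λ i → eq (F.suc i)))

∑-+-index : ∀ a b (g : Fin (a + b) → ℕ) →
  ∑ (a + b) g ≡ ∑ a (λ i → g (i ↑ˡ b)) + ∑ b (λ j → g (a ↑ʳ j))
∑-+-index zero    b g = refl
∑-+-index (suc a) b g =
  trans (cong (g F.zero +_) (∑-+-index a b (λ i → g (F.suc i))))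
        (sym (+-assoc (g F.zero) _ _))

∑-*-index : ∀ a b (g : Fin (a * b) → ℕ) →
  ∑ (a * b) g ≡ ∑ a (λ i → ∑ b (λ j → g (combine i j)))
∑-*-index zero    b g = refl
∑-*-index (suc a) b g =
  trans (∑-+-index b (a * b) g)
        (cong (∑ b (λ j → g (j ↑ˡ (a * b))) +_) (∑-*-index a b (λ x → g (b ↑ʳ x))))

∑-const : ∀ k c → ∑ k (λ _ → c) ≡ k * c
∑-const zero    c = refl
∑-const (suc k) c = cong (c +_) (∑-const k c)

∑-zero : ∀ k → ∑ k (λ _ → 0) ≡ 0
∑-zero k = trans (∑-const k 0) (*-zeroʳ k)

∑-+ : ∀ k (g h : Fin k → ℕ) → ∑ k (λ i → g i + h i) ≡ ∑ k g + ∑ k h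
∑-+ zero    g h = refl
∑-+ (suc k) g h =
  trans (cong (g F.zero + h F.zero +_) (∑-+ k _ _))
        (+-+-swap (g F.zero) (h F.zero) (∑ k _) (∑ k _))
  where
  +-+-swap : ∀ a b c d → a + b + (c + d) ≡ a + c + (b + d)
  +-+-swap = solve-∀

∑-*ʳ : ∀ k c (g : Fin k → ℕ) → ∑ k (λ i → g i * c) ≡ ∑ k g * c
∑-*ʳ zero    c g = refl
∑-*ʳ (suc k) c g =
  trans (cong (g F.zero * c +_) (∑-*ʳ k c _)) (sym (*-distribʳ-+ c (g F.zero) _))

∑-if : ∀ k (d : Bool) (h : Fin k → ℕ) → ∑ k (λ i → if d then h i else 0) ≡ (if d then ∑ k h else 0)
∑-if k true  h = refl
∑-if k false h = ∑-zero k

∑-delta : ∀ k (w : Fin k) (h : Fin k → ℕ) → ∑ k (λ i → if does (w F.≟ i) then h i else 0) ≡ h w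
∑-delta (suc k) F.zero    h = trans (cong (h F.zero +_) (∑-zero k)) (+-identityʳ _)
∑-delta (suc k) (F.suc w) h = ∑-delta k w (λ i → h (F.suc i))

∑-mono-< : ∀ k → 0 < k → (g h : Fin k → ℕ) → (∀ i → g i < h i) → ∑ k g < ∑ k h
∑-mono-< (suc k) _ g h lt = +-mono-<-≤ (lt F.zero) (∑-mono-≤ k _ _ (λ i → <⇒≤ (lt (F.suc i))))
  where
  ∑-mono-≤ : ∀ k (g h : Fin k → ℕ) → (∀ i → g i ≤ h i) → ∑ k g ≤ ∑ k h
  ∑-mono-≤ zero    g h le = z≤n
  ∑-mono-≤ (suc k) g h le = +-mono-≤ (le F.zero) (∑-mono-≤ k _ _ (λ i → le (F.suc i)))

lookup-injective : ∀ {A : Set} {xs : List A} → Unique xs → ∀ i j → lookup xs i ≡ lookup xs j → i ≡ j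
lookup-injective (_ ∷ _)    F.zero    F.zero    eq = refl
lookup-injective (x≢ ∷ _)   F.zero    (F.suc j) eq = ⊥-elim (All.lookup x≢ (∈-lookup j) eq)
lookup-injective (x≢ ∷ _)   (F.suc i) F.zero    eq = ⊥-elim (All.lookup x≢ (∈-lookup i) (sym eq))
lookup-injective (_ ∷ uxs)  (F.suc i) (F.suc j) eq = cong F.suc (lookup-injective uxs i j eq)

unique-⊆-length : ∀ {A : Set} {xs ys : List A} → Unique xs → xs ⊆ ys → length xs ≤ length ys
unique-⊆-length {xs = xs} {ys} uxs xs⊆ys = FP.injective⇒≤ {f = position} position-injective
  where
  position : Fin (length xs) → Fin (length ys)
  position i = index (xs⊆ys (∈-lookup i))

  position-injective : Injective _≡_ _≡_ position
  position-injective {i} {j} eq = lookup-injective uxs i j (begin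
    lookup xs i                    ≡⟨ lookup-index (xs⊆ys (∈-lookup i)) ⟩
    lookup ys (position i)         ≡⟨ cong (lookup ys) eq ⟩
    lookup ys (position j)         ≡⟨ lookup-index (xs⊆ys (∈-lookup j)) ⟨
    lookup xs j                    ∎)
    where open ≡-Reasoning

incident : ∀ {k} → Fin k → Fin k × Fin k → Bool
incident u pq = does (u F.≟ proj₁ pq) ∨ does (u F.≟ proj₂ pq)

weight : (G : Graph) → (Fin (m G) → ℕ) → Fin (V G) → ℕ
weight G w u = ∑ (m G) (λ e → if incident u (ends G e) then w e else 0)

fplus≡weight : ∀ G f u → fplus G f u ≡ weight G (label G f) u
fplus≡weight G f u = sum-allFin (m G) _

weight-cong : ∀ G {w w′ : Fin (m G) → ℕ} → (∀ e → w e ≡ w′ e) → ∀ u → weight G w u ≡ weight G w′ u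
weight-cong G eq u = ∑-cong (m G) (λ e → cong (if incident u (ends G e) then_else 0) (eq e))

weight-shift : ∀ G c (w : Fin (m G) → ℕ) u →
  weight G (λ e → c + w e) u ≡ weight G (λ _ → 1) u * c + weight G w u
weight-shift G c w u = begin
  weight G (λ e → c + w e) u
    ≡⟨ ∑-cong (m G) (λ e → split (incident u (ends G e)) (w e)) ⟩
  ∑ (m G) (λ e → (if incident u (ends G e) then 1 else 0) * c + (if incident u (ends G e) then w e else 0))
    ≡⟨ ∑-+ (m G) _ _ ⟩
  ∑ (m G) (λ e → (if incident u (ends G e) then 1 else 0) * c) + weight G w u
    ≡⟨ cong (_+ weight G w u) (∑-*ʳ (m G) c _) ⟩
  weight G (λ _ → 1) u * c + weight G w u ∎
  where
  open ≡-Reasoning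
  split : ∀ d x → (if d then c + x else 0) ≡ (if d then 1 else 0) * c + (if d then x else 0)
  split true  x = cong (_+ x) (sym (*-identityˡ c))
  split false x = refl

antimagic-separates : ∀ G f → IsLocalAntimagic G f → ∀ e {u v} → ends G e ≡ (u , v) →
  fplus G f u ≢ fplus G f v
antimagic-separates G f (_ , sep) e refl = sep e

triangle⇒3≤c : ∀ G f → IsLocalAntimagic G f → ∀ {u v w} e₁ e₂ e₃ →
  ends G e₁ ≡ (u , v) → ends G e₂ ≡ (u , w) → ends G e₃ ≡ (v , w) → 3 ≤ c G f
triangle⇒3≤c G f am {u} {v} {w} e₁ e₂ e₃ uv uw vw = unique-⊆-length distinct ⊆values
  where
  values : List ℕ
  values = deduplicate _≟_ (map (fplus G f) (allFin (V G)))
  value∈ : ∀ x → fplus G f x ∈ values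
  value∈ x = ∈-deduplicate⁺ _≟_ (∈-map⁺ (fplus G f) (∈-allFin x))
  triangle : List ℕ
  triangle = fplus G f u ∷ fplus G f v ∷ fplus G f w ∷ []
  distinct : Unique triangle
  distinct = (antimagic-separates G f am e₁ uv All.∷ antimagic-separates G f am e₂ uw All.∷ All.[])
           ∷ (antimagic-separates G f am e₃ vw All.∷ All.[]) ∷ All.[] ∷ []
  ⊆values : triangle ⊆ values
  ⊆values (here refl)                 = value∈ u
  ⊆values (there (here refl))         = value∈ v
  ⊆values (there (there (here refl))) = value∈ w

values⊆⇒c≤ : ∀ G f (vs : List ℕ) → (∀ u → fplus G f u ∈ vs) → c G f ≤ length vs
values⊆⇒c≤ G f vs inside = unique-⊆-length (deduplicate-! _) ⊆vs
  where
  ⊆vs : deduplicate _≟_ (map (fplus G f) (allFin (V G))) ⊆ vs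
  ⊆vs x∈ with ∈-map⁻ (fplus G f) (∈-deduplicate⁻ _≟_ _ x∈)
  ... | u , _ , refl = inside u

left-edge : ∀ G H → Fin (m G) → Fin (m (G ∨G H))
left-edge G H e = e ↑ˡ (m H + V G * V H)

right-edge : ∀ G H → Fin (m H) → Fin (m (G ∨G H))
right-edge G H e = m G ↑ʳ (e ↑ˡ V G * V H)

cross : ∀ G H → Fin (V G) → Fin (V H) → Fin (m (G ∨G H))
cross G H a b = m G ↑ʳ (m H ↑ʳ combine a b)

ends-left : ∀ G H e →
  ends (G ∨G H) (left-edge G H e) ≡ Prod.map (_↑ˡ V H) (_↑ˡ V H) (ends G e)
ends-left G H e rewrite FP.splitAt-↑ˡ (m G) e (m H + V G * V H) = refl

ends-right : ∀ G H e →
  ends (G ∨G H) (right-edge G H e) ≡ Prod.map (V G ↑ʳ_) (V G ↑ʳ_) (ends H e)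
ends-right G H e
  rewrite FP.splitAt-↑ʳ (m G) (m H + V G * V H) (e ↑ˡ V G * V H)
        | FP.splitAt-↑ˡ (m H) e (V G * V H) = refl

ends-cross : ∀ G H a b → ends (G ∨G H) (cross G H a b) ≡ (a ↑ˡ V H , V G ↑ʳ b)
ends-cross G H a b
  rewrite FP.splitAt-↑ʳ (m G) (m H + V G * V H) (m H ↑ʳ combine a b)
        | FP.splitAt-↑ʳ (m H) (V G * V H) (combine a b)
  = cong (λ ab → proj₁ ab ↑ˡ V H , V G ↑ʳ proj₂ ab) (FP.remQuot-combine a b)

-- Incidence in G ∨ H reduces to incidence in G or in H, because the two
-- injections into V(G ∨ H) are injective and have disjoint images.

does-injective : ∀ {a b} (g : Fin a → Fin b) → (∀ x y → g x ≡ g y → x ≡ y) →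
  ∀ x y → does (g x F.≟ g y) ≡ does (x F.≟ y)
does-injective g inj x y with x F.≟ y
... | yes refl = dec-true (g x F.≟ g x) refl
... | no x≢y   = dec-false (g x F.≟ g y) (λ eq → x≢y (inj x y eq))

↑ˡ≢↑ʳ : ∀ {m} k (x : Fin m) (y : Fin k) → x ↑ˡ k ≢ m ↑ʳ y
↑ˡ≢↑ʳ k F.zero    y ()
↑ˡ≢↑ʳ k (F.suc x) y eq = ↑ˡ≢↑ʳ k x y (FP.suc-injective eq)

incident-↑ˡ : ∀ {m} k (x : Fin m) pq →
  incident (x ↑ˡ k) (Prod.map (_↑ˡ k) (_↑ˡ k) pq) ≡ incident x pq
incident-↑ˡ k x (p , q) = cong₂ _∨_ (does-injective (_↑ˡ k) (FP.↑ˡ-injective k) x p)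
                                    (does-injective (_↑ˡ k) (FP.↑ˡ-injective k) x q)

incident-↑ʳ : ∀ {k} m (y : Fin k) pq →
  incident (m ↑ʳ y) (Prod.map (m ↑ʳ_) (m ↑ʳ_) pq) ≡ incident y pq
incident-↑ʳ m y (p , q) = cong₂ _∨_ (does-injective (m ↑ʳ_) (FP.↑ʳ-injective m) y p)
                                    (does-injective (m ↑ʳ_) (FP.↑ʳ-injective m) y q)

incident-↑ˡ-↑ʳ : ∀ {m} k (x : Fin m) pq → incident (x ↑ˡ k) (Prod.map (m ↑ʳ_) (m ↑ʳ_) pq) ≡ false
incident-↑ˡ-↑ʳ k x (p , q) = cong₂ _∨_ (dec-false (x ↑ˡ k F.≟ _) (↑ˡ≢↑ʳ k x p))
                                       (dec-false (x ↑ˡ k F.≟ _) (↑ˡ≢↑ʳ k x q))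

incident-↑ʳ-↑ˡ : ∀ {k} m (y : Fin k) pq → incident (m ↑ʳ y) (Prod.map (_↑ˡ k) (_↑ˡ k) pq) ≡ false
incident-↑ʳ-↑ˡ m y (p , q) = cong₂ _∨_ (dec-false (m ↑ʳ y F.≟ _) (λ eq → ↑ˡ≢↑ʳ _ p y (sym eq)))
                                       (dec-false (m ↑ʳ y F.≟ _) (λ eq → ↑ˡ≢↑ʳ _ q y (sym eq)))

incident-cross-left : ∀ {m} k (x a : Fin m) (b : Fin k) → incident (x ↑ˡ k) (a ↑ˡ k , m ↑ʳ b) ≡ does (x F.≟ a)
incident-cross-left k x a b = trans (cong₂ _∨_ (does-injective (_↑ˡ k) (FP.↑ˡ-injective k) x a)
                                              (dec-false (x ↑ˡ k F.≟ _) (↑ˡ≢↑ʳ k x b)))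
                                    (∨-identityʳ (does (x F.≟ a)))

incident-cross-right : ∀ {m} k (y : Fin k) (a : Fin m) b → incident (m ↑ʳ y) (a ↑ˡ k , m ↑ʳ b) ≡ does (y F.≟ b)
incident-cross-right {m} k y a b = cong₂ _∨_ (dec-false (m ↑ʳ y F.≟ _) (λ eq → ↑ˡ≢↑ʳ k a y (sym eq)))
                                             (does-injective (m ↑ʳ_) (FP.↑ʳ-injective m) y b)

weight-join-left : ∀ G H (w : Fin (m (G ∨G H)) → ℕ) x →
  weight (G ∨G H) w (x ↑ˡ V H) ≡
  weight G (λ e → w (left-edge G H e)) x + ∑ (V H) (λ b → w (cross G H x b))
weight-join-left G H w x = begin
  ∑ (m G + (m H + V G * V H)) term
    ≡⟨ ∑-+-index (m G) _ term ⟩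
  ∑ (m G) (λ e → term (left-edge G H e)) + ∑ (m H + V G * V H) (λ e → term (m G ↑ʳ e))
    ≡⟨ cong₂ _+_ (∑-cong (m G) inG) (∑-+-index (m H) _ _) ⟩
  weight G (λ e → w (left-edge G H e)) x +
    (∑ (m H) (λ e → term (right-edge G H e)) + ∑ (V G * V H) (λ p → term (m G ↑ʳ (m H ↑ʳ p))))
    ≡⟨ cong (weight G (λ e → w (left-edge G H e)) x +_) (cong₂ _+_ (trans (∑-cong (m H) inH) (∑-zero (m H)))
                                                        (∑-*-index (V G) (V H) _)) ⟩
  weight G (λ e → w (left-edge G H e)) x + ∑ (V G) (λ a → ∑ (V H) (λ b → term (cross G H a b)))
    ≡⟨ cong (weight G (λ e → w (left-edge G H e)) x +_) (∑-cong (V G) inCross) ⟩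
  weight G (λ e → w (left-edge G H e)) x + ∑ (V G) (λ a → if does (x F.≟ a) then ∑ (V H) (λ b → w (cross G H a b)) else 0)
    ≡⟨ cong (weight G (λ e → w (left-edge G H e)) x +_) (∑-delta (V G) x _) ⟩
  weight G (λ e → w (left-edge G H e)) x + ∑ (V H) (λ b → w (cross G H x b)) ∎
  where
  open ≡-Reasoning
  term : Fin (m (G ∨G H)) → ℕ
  term e = if incident (x ↑ˡ V H) (ends (G ∨G H) e) then w e else 0
  guard : ∀ e {d} → incident (x ↑ˡ V H) (ends (G ∨G H) e) ≡ d → term e ≡ (if d then w e else 0)
  guard e eq = cong (if_then w e else 0) eq
  inG : ∀ e → term (left-edge G H e) ≡ (if incident x (ends G e) then w (left-edge G H e) else 0)
  inG e = guard (left-edge G H e) (trans (cong (incident (x ↑ˡ V H)) (ends-left G H e)) (incident-↑ˡ (V H) x (ends G e)))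
  inH : ∀ e → term (right-edge G H e) ≡ 0
  inH e = guard (right-edge G H e) (trans (cong (incident (x ↑ˡ V H)) (ends-right G H e)) (incident-↑ˡ-↑ʳ (V H) x (ends H e)))
  inCross : ∀ a → ∑ (V H) (λ b → term (cross G H a b)) ≡
                  (if does (x F.≟ a) then ∑ (V H) (λ b → w (cross G H a b)) else 0)
  inCross a = trans (∑-cong (V H) (λ b → guard (cross G H a b)
                      (trans (cong (incident (x ↑ˡ V H)) (ends-cross G H a b)) (incident-cross-left (V H) x a b))))
                    (∑-if (V H) (does (x F.≟ a)) _)

weight-join-right : ∀ G H (w : Fin (m (G ∨G H)) → ℕ) y →
  weight (G ∨G H) w (V G ↑ʳ y) ≡
  weight H (λ e → w (right-edge G H e)) y + ∑ (V G) (λ a → w (cross G H a y))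
weight-join-right G H w y = begin
  ∑ (m G + (m H + V G * V H)) term
    ≡⟨ ∑-+-index (m G) _ term ⟩
  ∑ (m G) (λ e → term (left-edge G H e)) + ∑ (m H + V G * V H) (λ e → term (m G ↑ʳ e))
    ≡⟨ cong₂ _+_ (trans (∑-cong (m G) inG) (∑-zero (m G))) (∑-+-index (m H) _ _) ⟩
  ∑ (m H) (λ e → term (right-edge G H e)) + ∑ (V G * V H) (λ p → term (m G ↑ʳ (m H ↑ʳ p)))
    ≡⟨ cong₂ _+_ (∑-cong (m H) inH) (∑-*-index (V G) (V H) _) ⟩
  weight H (λ e → w (right-edge G H e)) y + ∑ (V G) (λ a → ∑ (V H) (λ b → term (cross G H a b)))
    ≡⟨ cong (weight H (λ e → w (right-edge G H e)) y +_) (∑-cong (V G) inCross) ⟩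
  weight H (λ e → w (right-edge G H e)) y + ∑ (V G) (λ a → w (cross G H a y)) ∎
  where
  open ≡-Reasoning
  term : Fin (m (G ∨G H)) → ℕ
  term e = if incident (V G ↑ʳ y) (ends (G ∨G H) e) then w e else 0
  guard : ∀ e {d} → incident (V G ↑ʳ y) (ends (G ∨G H) e) ≡ d → term e ≡ (if d then w e else 0)
  guard e eq = cong (if_then w e else 0) eq
  inG : ∀ e → term (left-edge G H e) ≡ 0
  inG e = guard (left-edge G H e) (trans (cong (incident (V G ↑ʳ y)) (ends-left G H e)) (incident-↑ʳ-↑ˡ (V G) y (ends G e)))
  inH : ∀ e → term (right-edge G H e) ≡ (if incident y (ends H e) then w (right-edge G H e) else 0)
  inH e = guard (right-edge G H e) (trans (cong (incident (V G ↑ʳ y)) (ends-right G H e)) (incident-↑ʳ (V G) y (ends H e)))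
  inCross : ∀ a → ∑ (V H) (λ b → term (cross G H a b)) ≡ w (cross G H a y)
  inCross a = trans (∑-cong (V H) (λ b → guard (cross G H a b)
                      (trans (cong (incident (V G ↑ʳ y)) (ends-cross G H a b)) (incident-cross-right (V H) y a b))))
                    (∑-delta (V H) y _)

join-vertex-elim : ∀ G H (P : Fin (V (G ∨G H)) → Set) →
  (∀ x → P (x ↑ˡ V H)) → (∀ y → P (V G ↑ʳ y)) → ∀ u → P u
join-vertex-elim G H P left right u with splitAt (V G) u in eq
... | inj₁ x = subst P (FP.splitAt⁻¹-↑ˡ eq) (left x)
... | inj₂ y = subst P (FP.splitAt⁻¹-↑ʳ eq) (right y)

join-edge-elim : ∀ G H (P : Fin (m (G ∨G H)) → Set) →
  (∀ e → P (left-edge G H e)) → (∀ e → P (right-edge G H e)) → (∀ a b → P (cross G H a b)) → ∀ e → P e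
join-edge-elim G H P left right across e with splitAt (m G) e in eq₁
... | inj₁ i = subst P (FP.splitAt⁻¹-↑ˡ eq₁) (left i)
... | inj₂ j with splitAt (m H) j in eq₂
...   | inj₁ k = subst P (trans (cong (m G ↑ʳ_) (FP.splitAt⁻¹-↑ˡ eq₂)) (FP.splitAt⁻¹-↑ʳ eq₁)) (right k)
...   | inj₂ p = subst P (trans (cong (λ q → m G ↑ʳ (m H ↑ʳ q)) (FP.combine-remQuot {V G} (V H) p))
                         (trans (cong (m G ↑ʳ_) (FP.splitAt⁻¹-↑ʳ eq₂)) (FP.splitAt⁻¹-↑ʳ eq₁)))
                         (across (proj₁ (remQuot {V G} (V H) p)) (proj₂ (remQuot {V G} (V H) p)))

-- Folding two copies of Fin k onto Fin (k + k): the first copy in order, the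
-- second one reflected, so that the two entries of each pair (0 , x), (1 , x)
-- sum to the same value.

fold : ∀ k → Fin 2 × Fin k → Fin (k + k)
fold k (0F , x) = x ↑ˡ k
fold k (1F , x) = k ↑ʳ opposite x

unfold : ∀ k → Fin (k + k) → Fin 2 × Fin k
unfold k y = [ (λ x → 0F , x) , (λ x → 1F , opposite x) ]′ (splitAt k y)

fold-↔ : ∀ k → (Fin 2 × Fin k) ↔ Fin (k + k)
fold-↔ k = mk↔ₛ′ (fold k) (unfold k) fold-unfold unfold-fold
  where
  fold-unfold : ∀ y → fold k (unfold k y) ≡ y
  fold-unfold y with splitAt k y in eq
  ... | inj₁ x = FP.splitAt⁻¹-↑ˡ eq
  ... | inj₂ x = trans (cong (k ↑ʳ_) (FP.opposite-involutive x)) (FP.splitAt⁻¹-↑ʳ eq)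
  unfold-fold : ∀ p → unfold k (fold k p) ≡ p
  unfold-fold (0F , x) rewrite FP.splitAt-↑ˡ k x k = refl
  unfold-fold (1F , x) rewrite FP.splitAt-↑ʳ k k (opposite x) = cong (1F ,_) (FP.opposite-involutive x)

fold-pair : ∀ k x → suc (toℕ (fold k (0F , x))) + suc (toℕ (fold k (1F , x))) ≡ suc (k + k)
fold-pair k x = begin
  suc (toℕ (x ↑ˡ k)) + suc (toℕ (k ↑ʳ opposite x))
    ≡⟨ cong₂ (λ a b → suc a + suc b) (FP.toℕ-↑ˡ x k) (trans (FP.toℕ-↑ʳ k (opposite x)) (cong (k +_) (FP.opposite-prop x))) ⟩
  suc (toℕ x) + suc (k + (k ∸ suc (toℕ x)))
    ≡⟨ regroup (suc (toℕ x)) k (k ∸ suc (toℕ x)) ⟩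
  suc (k + (suc (toℕ x) + (k ∸ suc (toℕ x))))
    ≡⟨ cong (λ r → suc (k + r)) (m+[n∸m]≡n (FP.toℕ<n x)) ⟩
  suc (k + k) ∎
  where
  open ≡-Reasoning
  regroup : ∀ a k r → a + suc (k + r) ≡ suc (k + (a + r))
  regroup = solve-∀

fold-0<1 : ∀ k x → toℕ (fold k (0F , x)) < toℕ (fold k (1F , x))
fold-0<1 k x = begin-strict
  toℕ (x ↑ˡ k)              ≡⟨ FP.toℕ-↑ˡ x k ⟩
  toℕ x                     <⟨ FP.toℕ<n x ⟩
  k                         ≤⟨ m≤m+n k _ ⟩
  k + toℕ (opposite x)      ≡⟨ FP.toℕ-↑ʳ k (opposite x) ⟨
  toℕ (k ↑ʳ opposite x)     ∎
  where open ≤-Reasoning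

cast-↔ : ∀ {a b} → a ≡ b → Fin a ↔ Fin b
cast-↔ eq = mk↔ₛ′ (cast eq) (cast (sym eq)) (FP.cast-involutive eq (sym eq)) (FP.cast-involutive (sym eq) eq)

-- A labeling of the nine edges of M₆ by 0,…,8 under which every vertex has
-- sum 12 (it swaps 0↔5, 2↔3, 6↔7).
σ : Fin 9 → Fin 9
σ 0F = 5F
σ 1F = 1F
σ 2F = 3F
σ 3F = 2F
σ 4F = 4F
σ 5F = 0F
σ 6F = 7F
σ 7F = 6F
σ 8F = 8F

σ-involutive : ∀ k → σ (σ k) ≡ k
σ-involutive 0F = refl
σ-involutive 1F = refl
σ-involutive 2F = refl
σ-involutive 3F = refl
σ-involutive 4F = refl
σ-involutive 5F = refl
σ-involutive 6F = refl
σ-involutive 7F = refl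
σ-involutive 8F = refl

σ-↔ : Fin 9 ↔ Fin 9
σ-↔ = mk↔ₛ′ σ σ σ-involutive σ-involutive

σ-magic : ∀ x → weight M6 (λ k → toℕ (σ k)) x ≡ 12
σ-magic 0F = refl
σ-magic 1F = refl
σ-magic 2F = refl
σ-magic 3F = refl
σ-magic 4F = refl
σ-magic 5F = refl

M6-cubic : ∀ x → weight M6 (λ _ → 1) x ≡ 3
M6-cubic 0F = refl
M6-cubic 1F = refl
M6-cubic 2F = refl
M6-cubic 3F = refl
M6-cubic 4F = refl
M6-cubic 5F = refl

-- Writing a vertex of M₆ as combine j t = 2j + t, M₆ is bipartite with sides t.
side : Fin 6 → Fin 2
side x = proj₂ (remQuot {3} 2 x)

M6-bipartite : ∀ k → side (proj₁ (ends M6 k)) ≢ side (proj₂ (ends M6 k))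
M6-bipartite 0F ()
M6-bipartite 1F ()
M6-bipartite 2F ()
M6-bipartite 3F ()
M6-bipartite 4F ()
M6-bipartite 5F ()
M6-bipartite 6F ()
M6-bipartite 7F ()
M6-bipartite 8F ()

-- Index the vertices of M₆ as combine j t (j < 3, t < 2) and those of O₂ₙ as
-- combine r i (r < 2, i < n).  The cross edge between them receives the value
-- fold K (t , combine i (fold 3 (r , j))), where K = 6n.  The M₆ edges receive
-- the nine largest values 2K + σ k.
module Labelling (n : ℕ) where

  K : ℕ
  K = n * 6

  at : Fin 3 → Fin 2 → Fin 6
  at j t = combine j t

  regroup-↔ : ((Fin 3 × Fin 2) × (Fin 2 × Fin n)) ↔ (Fin 2 × (Fin n × (Fin 2 × Fin 3)))
  regroup-↔ = mk↔ₛ′ (λ ((j , t) , (r , i)) → t , i , r , j) (λ (t , i , r , j) → (j , t) , (r , i))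
                    (λ _ → refl) (λ _ → refl)

  -- The values of the cross edges, as a composite of bijections:
  -- (at j t , combine r i) ↦ ((j , t) , (r , i)) ↦ (t , i , r , j) ↦ fold K (t , combine i (fold 3 (r , j))).
  block-↔ : (Fin 6 × Fin (2 * n)) ↔ Fin (K + K)
  block-↔ = fold-↔ K
        ↔-∘ ((↔-id (Fin 2) ×-↔ (↔-sym FP.*↔× ↔-∘ (↔-id (Fin n) ×-↔ fold-↔ 3)))
        ↔-∘ (regroup-↔
        ↔-∘ (FP.*↔× ×-↔ FP.*↔×)))

  block : Fin 6 × Fin (2 * n) → Fin (K + K)
  block = Inverse.to block-↔

  block-at-vertex : ∀ j t b → block (at j t , b) ≡
    fold K (t , combine (proj₂ (remQuot {2} n b)) (fold 3 (proj₁ (remQuot {2} n b) , j)))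
  block-at-vertex j t b =
    cong (λ jt → fold K (proj₂ jt , combine (proj₂ (remQuot {2} n b)) (fold 3 (proj₁ (remQuot {2} n b) , proj₁ jt))))
         (FP.remQuot-combine j t)

  block-at-edge : ∀ j t r i → block (at j t , combine r i) ≡ fold K (t , combine i (fold 3 (r , j)))
  block-at-edge j t r i =
    trans (block-at-vertex j t (combine r i))
          (cong (λ ri → fold K (t , combine (proj₂ ri) (fold 3 (proj₁ ri , j)))) (FP.remQuot-combine {2} {n} r i))

  lab : Fin 6 → Fin (2 * n) → ℕ
  lab a b = suc (toℕ (block (a , b)))

  pair-sum : ∀ j b → lab (at j 0F) b + lab (at j 1F) b ≡ suc (K + K)
  pair-sum j b rewrite block-at-vertex j 0F b | block-at-vertex j 1F b = fold-pair K _

  column-sum : ∀ b → ∑ 6 (λ a → lab a b) ≡ 3 * suc (K + K)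
  column-sum b = begin
    ∑ 6 (λ a → lab a b)                                           ≡⟨ ∑-*-index 3 2 (λ a → lab a b) ⟩
    ∑ 3 (λ j → lab (at j 0F) b + (lab (at j 1F) b + 0))  ≡⟨ ∑-cong 3 pair ⟩
    ∑ 3 (λ _ → suc (K + K))                                       ≡⟨ ∑-const 3 (suc (K + K)) ⟩
    3 * suc (K + K)                                               ∎
    where
    open ≡-Reasoning
    pair : ∀ j → lab (at j 0F) b + (lab (at j 1F) b + 0) ≡ suc (K + K)
    pair j = trans (cong (lab (at j 0F) b +_) (+-identityʳ _)) (pair-sum j b)

  row : Fin 6 → ℕ
  row a = ∑ (2 * n) (lab a)

  evenRow : ℕ
  evenRow = ∑ n (λ i → 6 * toℕ i + 6 * toℕ i + 7)

  -- On the side t = 0 the labels are 6i + fold 3 (r , j) + 1, and the two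
  -- values of r contribute 7 in total, whatever j is.
  row-even : ∀ j → row (at j 0F) ≡ evenRow
  row-even j = begin
    row (at j 0F)                                   ≡⟨ ∑-*-index 2 n (lab (at j 0F)) ⟩
    ∑ n (entry 0F) + (∑ n (entry 1F) + 0)                ≡⟨ cong (∑ n (entry 0F) +_) (+-identityʳ _) ⟩
    ∑ n (entry 0F) + ∑ n (entry 1F)                      ≡⟨ ∑-+ n _ _ ⟨
    ∑ n (λ i → entry 0F i + entry 1F i)                  ≡⟨ ∑-cong n pair ⟩
    evenRow                                              ∎
    where
    open ≡-Reasoning
    entry : Fin 2 → Fin n → ℕ
    entry r i = lab (at j 0F) (combine r i)
    entry≡ : ∀ r i → entry r i ≡ suc (6 * toℕ i + toℕ (fold 3 (r , j)))
    entry≡ r i = cong suc (trans (cong toℕ (block-at-edge j 0F r i))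
                                 (trans (FP.toℕ-↑ˡ _ K) (FP.toℕ-combine i _)))
    regroup : ∀ x p q → suc (x + p) + suc (x + q) ≡ x + x + (suc p + suc q)
    regroup = solve-∀
    pair : ∀ i → entry 0F i + entry 1F i ≡ 6 * toℕ i + 6 * toℕ i + 7
    pair i = trans (cong₂ _+_ (entry≡ 0F i) (entry≡ 1F i))
                   (trans (regroup (6 * toℕ i) _ _) (cong (6 * toℕ i + 6 * toℕ i +_) (fold-pair 3 j)))

  oddRow : ℕ
  oddRow = 2 * n * suc (K + K) ∸ evenRow

  -- On the side t = 1 each label complements the t = 0 label of the same column.
  row-odd : ∀ j → row (at j 1F) ≡ oddRow
  row-odd j = begin
    row (at j 1F)                             ≡⟨ m+n∸n≡m (row (at j 1F)) evenRow ⟨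
    row (at j 1F) + evenRow ∸ evenRow         ≡⟨ cong (λ s → row (at j 1F) + s ∸ evenRow) (row-even j) ⟨
    row (at j 1F) + row (at j 0F) ∸ evenRow ≡⟨ cong (_∸ evenRow) (+-comm (row (at j 1F)) _) ⟩
    row (at j 0F) + row (at j 1F) ∸ evenRow ≡⟨ cong (_∸ evenRow) rows ⟩
    oddRow                                         ∎
    where
    open ≡-Reasoning
    rows : row (at j 0F) + row (at j 1F) ≡ 2 * n * suc (K + K)
    rows = trans (sym (∑-+ (2 * n) _ _)) (trans (∑-cong (2 * n) (pair-sum j)) (∑-const (2 * n) _))

  rowSum : Fin 2 → ℕ
  rowSum 0F = evenRow
  rowSum 1F = oddRow

  row-side : ∀ a → row a ≡ rowSum (side a)
  row-side a = trans (cong row (sym (FP.combine-remQuot {3} 2 a)))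
                     (by-side (proj₁ (remQuot {3} 2 a)) (proj₂ (remQuot {3} 2 a)))
    where
    by-side : ∀ j t → row (at j t) ≡ rowSum t
    by-side j 0F = row-even j
    by-side j 1F = row-odd j

  -- The two sides are told apart: on side 1 every label is the larger one of its pair.
  evenRow<oddRow : 1 ≤ n → evenRow < oddRow
  evenRow<oddRow 1≤n = begin-strict
    evenRow         ≡⟨ row-even 0F ⟨
    row (at 0F 0F)  <⟨ ∑-mono-< (2 * n) (≤-trans 1≤n (m≤m+n n _)) _ _ smaller ⟩
    row (at 0F 1F)  ≡⟨ row-odd 0F ⟩
    oddRow          ∎
    where
    open ≤-Reasoning
    smaller : ∀ b → lab (at 0F 0F) b < lab (at 0F 1F) b
    smaller b rewrite block-at-vertex 0F 0F b | block-at-vertex 0F 1F b = s≤s (fold-0<1 K _)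

  -- The whole labeling: cross edges get the values below 2K via block, the
  -- M₆ edges the nine values 2K + σ k above them.
  arrange-↔ : (Fin 9 ⊎ Fin (6 * (2 * n))) ↔ Fin (9 + 6 * (2 * n))
  arrange-↔ = cast-↔ size
          ↔-∘ (↔-sym FP.+↔⊎
          ↔-∘ (⊎-comm _ _
          ↔-∘ (σ-↔ ⊎-↔ (block-↔ ↔-∘ FP.*↔×))))
    where
    sizes : ∀ n → n * 6 + n * 6 + 9 ≡ 9 + 6 * (2 * n)
    sizes = solve-∀
    size : K + K + 9 ≡ 9 + 6 * (2 * n)
    size = sizes n

  arrange : Fin 9 ⊎ Fin (6 * (2 * n)) → Fin (9 + 6 * (2 * n))
  arrange = Inverse.to arrange-↔

  labelling-↔ : Fin (9 + 6 * (2 * n)) ↔ Fin (9 + 6 * (2 * n))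
  labelling-↔ = arrange-↔ ↔-∘ FP.+↔⊎

  labelling : Fin (9 + 6 * (2 * n)) → Fin (9 + 6 * (2 * n))
  labelling = Inverse.to labelling-↔

  labelling-bijective : Bijective _≡_ _≡_ labelling
  labelling-bijective = Bijection.bijective (Inverse⇒Bijection labelling-↔)

  labelling-M6 : ∀ k → toℕ (labelling (k ↑ˡ 6 * (2 * n))) ≡ K + K + toℕ (σ k)
  labelling-M6 k = begin
    toℕ (labelling (k ↑ˡ 6 * (2 * n)))  ≡⟨ cong (λ s → toℕ (arrange s)) (FP.splitAt-↑ˡ 9 k (6 * (2 * n))) ⟩
    toℕ (arrange (inj₁ k))              ≡⟨ FP.toℕ-cast _ (K + K ↑ʳ σ k) ⟩
    toℕ (K + K ↑ʳ σ k)                  ≡⟨ FP.toℕ-↑ʳ (K + K) (σ k) ⟩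
    K + K + toℕ (σ k)                   ∎
    where open ≡-Reasoning

  labelling-cross : ∀ a b → toℕ (labelling (9 ↑ʳ combine a b)) ≡ toℕ (block (a , b))
  labelling-cross a b = begin
    toℕ (labelling (9 ↑ʳ combine a b))   ≡⟨ cong (λ s → toℕ (arrange s)) (FP.splitAt-↑ʳ 9 (6 * (2 * n)) (combine a b)) ⟩
    toℕ (arrange (inj₂ (combine a b)))   ≡⟨ FP.toℕ-cast _ (block (remQuot (2 * n) (combine a b)) ↑ˡ 9) ⟩
    toℕ (block (remQuot (2 * n) (combine a b)) ↑ˡ 9) ≡⟨ FP.toℕ-↑ˡ _ 9 ⟩
    toℕ (block (remQuot (2 * n) (combine a b)))      ≡⟨ cong (λ p → toℕ (block p)) (FP.remQuot-combine a b) ⟩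
    toℕ (block (a , b))                  ∎
    where open ≡-Reasoning

module VertexSums (n : ℕ) where
  open Labelling n

  Gr : Graph
  Gr = M6 ∨G O (2 * n)

  N : ℕ
  N = suc (K + K)

  M6-vertex : Fin 6 → Fin (V Gr)
  M6-vertex x = x ↑ˡ 2 * n

  O-vertex : Fin (2 * n) → Fin (V Gr)
  O-vertex y = 6 ↑ʳ y

  M6-edge : Fin 9 → Fin (m Gr)
  M6-edge = left-edge M6 (O (2 * n))

  sideValue : Fin 2 → ℕ
  sideValue t = 3 * N + 12 + rowSum t

  otherValue : ℕ
  otherValue = 3 * N

  -- An M₆-vertex: its three M₆ edges carry 3N + 12 (σ is vertex-magic and M₆
  -- is cubic), and its cross edges carry its row sum.
  value-M6 : ∀ x → fplus Gr labelling (M6-vertex x) ≡ sideValue (side x)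
  value-M6 x = begin
    fplus Gr labelling (M6-vertex x)
      ≡⟨ fplus≡weight Gr labelling (M6-vertex x) ⟩
    weight Gr (label Gr labelling) (M6-vertex x)
      ≡⟨ weight-join-left M6 (O (2 * n)) (label Gr labelling) x ⟩
    weight M6 (λ k → suc (toℕ (labelling (M6-edge k)))) x + ∑ (2 * n) (λ b → suc (toℕ (labelling (9 ↑ʳ combine x b))))
      ≡⟨ cong₂ _+_ (weight-cong M6 (λ k → cong suc (labelling-M6 k)) x)
                   (∑-cong (2 * n) (λ b → cong suc (labelling-cross x b))) ⟩
    weight M6 (λ k → N + toℕ (σ k)) x + row x
      ≡⟨ cong (_+ row x) (weight-shift M6 N (λ k → toℕ (σ k)) x) ⟩
    weight M6 (λ _ → 1) x * N + weight M6 (λ k → toℕ (σ k)) x + row x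
      ≡⟨ cong₂ (λ d s → d * N + s + row x) (M6-cubic x) (σ-magic x) ⟩
    3 * N + 12 + row x
      ≡⟨ cong (3 * N + 12 +_) (row-side x) ⟩
    sideValue (side x) ∎
    where open ≡-Reasoning

  value-O : ∀ y → fplus Gr labelling (O-vertex y) ≡ otherValue
  value-O y = begin
    fplus Gr labelling (O-vertex y)                        ≡⟨ fplus≡weight Gr labelling (O-vertex y) ⟩
    weight Gr (label Gr labelling) (O-vertex y)            ≡⟨ weight-join-right M6 (O (2 * n)) (label Gr labelling) y ⟩
    ∑ 6 (λ a → suc (toℕ (labelling (9 ↑ʳ combine a y)))) ≡⟨ ∑-cong 6 (λ a → cong suc (labelling-cross a y)) ⟩
    ∑ 6 (λ a → lab a y)                                ≡⟨ column-sum y ⟩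
    otherValue                                         ∎
    where open ≡-Reasoning

  sideValue-injective : 1 ≤ n → ∀ t t′ → t ≢ t′ → sideValue t ≢ sideValue t′
  sideValue-injective 1≤n 0F 0F t≢t′ = ⊥-elim (t≢t′ refl)
  sideValue-injective 1≤n 0F 1F _    = <⇒≢ (+-monoʳ-< (3 * N + 12) (evenRow<oddRow 1≤n))
  sideValue-injective 1≤n 1F 0F _    = ≢-sym (<⇒≢ (+-monoʳ-< (3 * N + 12) (evenRow<oddRow 1≤n)))
  sideValue-injective 1≤n 1F 1F t≢t′ = ⊥-elim (t≢t′ refl)

  otherValue<sideValue : ∀ t → otherValue < sideValue t
  otherValue<sideValue t = ≤-trans (m<m+n (3 * N) (s≤s z≤n)) (m≤m+n (3 * N + 12) (rowSum t))

  -- The labeling is local antimagic: M₆ edges join the two sides, and cross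
  -- edges join an M₆-vertex to an O₂ₙ-vertex.
  labelling-antimagic : 1 ≤ n → IsLocalAntimagic Gr labelling
  labelling-antimagic 1≤n = labelling-bijective , join-edge-elim M6 (O (2 * n)) Separated onM6 (λ ()) onCross
    where
    Separated : Fin (m Gr) → Set
    Separated e = fplus Gr labelling (proj₁ (ends Gr e)) ≢ fplus Gr labelling (proj₂ (ends Gr e))
    separated : ∀ e {u v} → ends Gr e ≡ (u , v) → fplus Gr labelling u ≢ fplus Gr labelling v → Separated e
    separated e eq apart = subst (λ uv → fplus Gr labelling (proj₁ uv) ≢ fplus Gr labelling (proj₂ uv)) (sym eq) apart
    onM6 : ∀ k → Separated (M6-edge k)
    onM6 k = separated (M6-edge k) (ends-left M6 (O (2 * n)) k) λ eq →
      sideValue-injective 1≤n _ _ (M6-bipartite k)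
        (trans (sym (value-M6 (proj₁ (ends M6 k)))) (trans eq (value-M6 (proj₂ (ends M6 k)))))
    onCross : ∀ a b → Separated (cross M6 (O (2 * n)) a b)
    onCross a b = separated (cross M6 (O (2 * n)) a b) (ends-cross M6 (O (2 * n)) a b) λ eq →
      <⇒≢ (otherValue<sideValue (side a)) (trans (sym (value-O b)) (trans (sym eq) (value-M6 a)))

  values : List ℕ
  values = sideValue 0F ∷ sideValue 1F ∷ otherValue ∷ []

  c≤3 : c Gr labelling ≤ 3
  c≤3 = values⊆⇒c≤ Gr labelling values
          (join-vertex-elim M6 (O (2 * n)) _ onM6 onO)
    where
    sideValue∈ : ∀ t → sideValue t ∈ values
    sideValue∈ 0F = here refl
    sideValue∈ 1F = there (here refl)
    onM6 : ∀ x → fplus Gr labelling (M6-vertex x) ∈ values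
    onM6 x = subst (_∈ values) (sym (value-M6 x)) (sideValue∈ (side x))
    onO : ∀ y → fplus Gr labelling (O-vertex y) ∈ values
    onO y = there (there (here (value-O y)))

  -- At least three values for every local antimagic labeling: the vertices
  -- u₁, u₂ of M₆ and any vertex of O₂ₙ form a triangle.
  3≤c : Fin (2 * n) → ∀ g → IsLocalAntimagic Gr g → 3 ≤ c Gr g
  3≤c b g am = triangle⇒3≤c Gr g am {M6-vertex 0F} {M6-vertex 1F} {O-vertex b} (M6-edge 0F) (cross M6 (O (2 * n)) 0F b) (cross M6 (O (2 * n)) 1F b)
                 (ends-left M6 (O (2 * n)) 0F) (ends-cross M6 (O (2 * n)) 0F b) (ends-cross M6 (O (2 * n)) 1F b)

mainTheorem10 : (n : ℕ) → 1 ≤ n → χla≡ (M6 ∨G O (2 * n)) 3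
mainTheorem10 n@(suc _) 1≤n = (labelling , antimagic , ≤-antisym c≤3 (3≤c F.zero labelling antimagic))
                             , 3≤c F.zero
  where
  open Labelling n
  open VertexSums n
  antimagic : IsLocalAntimagic Gr labelling
  antimagic = labelling-antimagic 1≤n
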